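{- Fix a permutation $\pi\in S_n$. For each right element $a$ there is a left-straight element $b$ such that $(a,b)$ is an inversion; and for each left element $a$ there is a right-straight element $b$ such that $(b,a)$ is an inversion.
   Context: An inversion of $\pi$ is a pair $(a,b)$ with $a>b$ and $a$ occurring at an earlier position than $b$ in $\pi$. Element $i$ is right if it appears in some inversion $(i,j)$, and left if it appears in some inversion $(j,i)$; it is left-straight if it is left but not right, and right-straight if it is right but not left. -}

module Defs where

open import Data.Nat using (ℕ)
open import Data.Fin using (Fin; _<_)
open import Data.Fin.Permutation using (Permutation′; _⟨$⟩ˡ_)
open import Data.Product using (∃; _×_)
open import Relation.Nullary using (¬_)

-- A permutation π ∈ S_n in one-line notation: π ⟨$⟩ʳ i is the entry at
-- position i; hence the position of the value a is  pos π a = π ⟨$⟩ˡ a.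
pos : ∀ {n} → Permutation′ n → Fin n → Fin n
pos π a = π ⟨$⟩ˡ a

Inversion : ∀ {n} → Permutation′ n → Fin n → Fin n → Set
Inversion π a b = (b < a) × (pos π a < pos π b)

Right : ∀ {n} → Permutation′ n → Fin n → Set
Right π i = ∃ λ j → Inversion π i j

Left : ∀ {n} → Permutation′ n → Fin n → Set
Left π i = ∃ λ j → Inversion π j i

LeftStraight : ∀ {n} → Permutation′ n → Fin n → Set
LeftStraight π i = Left π i × ¬ Right π i

RightStraight : ∀ {n} → Permutation′ n → Fin n → Set
RightStraight π i = Right π i × ¬ Left π i

module Submission where

-- Inversions compose: if (a , b) and (b , c) are inversions, so is (a , c).
-- Hence the smallest b with (a , b) an inversion cannot be right, and the
-- largest b with (b , a) an inversion cannot be left.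

open import Defs
open import Data.Nat using (ℕ)
open import Data.Fin using (Fin)
open import Data.Fin.Permutation using (Permutation′)
open import Data.Fin.Properties using (_<?_; <-trans; any?)
open import Data.Fin.Induction using (<-wellFounded; >-wellFounded)
open import Data.Product using (∃; _×_; _,_; proj₁)
open import Induction.WellFounded using (Acc; acc; WellFounded)
open import Level using (Level)
open import Relation.Binary using (Rel; Decidable)
open import Relation.Nullary using (¬_; yes; no)
open import Relation.Nullary.Decidable using (_×-dec_)
open import Relation.Unary using (Pred)
import Relation.Unary as U

module _ {n : ℕ} {r p : Level} {R : Rel (Fin n) r} (R? : Decidable R)
         {P : Pred (Fin n) p} (P? : U.Decidable P) where

  minimal-witness : WellFounded R → ∀ {x} → P x →
                    ∃ λ b → P b × (∀ c → R c b → ¬ P c)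
  minimal-witness wf {x} = go x (wf x)
    where
    go : ∀ x → Acc R x → P x → ∃ λ b → P b × (∀ c → R c b → ¬ P c)
    go x (acc rs) px with any? (λ y → R? y x ×-dec P? y)
    ... | yes (y , ryx , py) = go y (rs ryx) py
    ... | no ¬below          = x , px , λ c rcx pc → ¬below (c , rcx , pc)

module _ {n : ℕ} (π : Permutation′ n) where

  inversion? : Decidable (Inversion π)
  inversion? a b = (b <? a) ×-dec (pos π a <? pos π b)

  inversion-trans : ∀ {a b c} → Inversion π a b → Inversion π b c → Inversion π a c
  inversion-trans (b<a , pa<pb) (c<b , pb<pc) = <-trans c<b b<a , <-trans pa<pb pb<pc

  right⇒inversion-leftStraight : ∀ a → Right π a → ∃ λ b → LeftStraight π b × Inversion π a b
  right⇒inversion-leftStraight a (_ , a⇝j) with minimal-witness _<?_ (inversion? a) <-wellFounded a⇝j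
  ... | b , a⇝b , minimal =
    b , ((a , a⇝b) , λ (c , b⇝c) → minimal c (proj₁ b⇝c) (inversion-trans a⇝b b⇝c)) , a⇝b

  left⇒inversion-rightStraight : ∀ a → Left π a → ∃ λ b → RightStraight π b × Inversion π b a
  left⇒inversion-rightStraight a (_ , j⇝a) with minimal-witness (λ x y → y <? x) (λ b → inversion? b a) >-wellFounded j⇝a
  ... | b , b⇝a , maximal =
    b , ((a , b⇝a) , λ (c , c⇝b) → maximal c (proj₁ c⇝b) (inversion-trans c⇝b b⇝a)) , b⇝a

lemma4 : (n : ℕ) (π : Permutation′ n) →
    ((a : Fin n) → Right π a → ∃ λ b → LeftStraight π b × Inversion π a b)
    × ((a : Fin n) → Left π a → ∃ λ b → RightStraight π b × Inversion π b a)
lemma4 n π = right⇒inversion-leftStraight π , left⇒inversion-rightStraight π
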